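{- Let $p$ be a prime with $p-1=2^iq_1^{j_1}q_2^{j_2}$, where $q_1\neq q_2$ are odd primes and $i,j_1,j_2\ge 1$. Let $g$ be a generator of $\mathbb{Z}_p^*$ and $1\le k\le i$. The number $a_k$ of elements of $\mathcal{NI}(g)$ that generate the (unique) subgroup of $\mathbb{Z}_p^*$ of order $\frac{p-1}{2^k}$, i.e. have multiplicative order exactly $\frac{p-1}{2^k}$, is $$a_k=\begin{cases}\frac{1}{2^k}|\mathcal{NI}(g)| & \text{if } 1\le k\le i-1,\\[2pt] \frac{1}{2^{k-1}}|\mathcal{NI}(g)| & \text{if } k=i.\end{cases}$$
   Context: $\mathcal{G}$ is the set of generators of $\mathbb{Z}_p^*$, $\mathcal{R}$ the set of quadratic residues in $\mathbb{Z}_p^*$, $\mathcal{NG}$ the set of quadratic non-residues that are not generators. For $g\in\mathcal{G}$: $\bar{\mathcal{R}}_g=\{r\in\mathcal{R}: gr\in\mathcal{NG}\}$ and $\mathcal{NI}(g)=\bar{\mathcal{R}}_g\cap\bar{\mathcal{R}}_{g^{ -1}}$ (products mod $p$). For such $p$ one has $|\mathcal{NI}(g)|=2^iq_1^{j_1-1}q_2^{j_2-1}$. -}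

module Defs where

open import Data.Nat using (ℕ; zero; suc; _+_; _*_; _∸_; _^_; _≤_; _<_; NonZero; _≡ᵇ_)
open import Data.Nat.DivMod using (_%_; _/_)
open import Data.Nat.Properties using (m^n≢0)
open import Data.Bool using (Bool; true; false; _∧_; not)
open import Data.List using (List; []; _∷_; map; filter; length; upTo)
open import Data.Bool.ListAction using (any; all)
open import Data.Bool using (T)
open import Relation.Nullary.Decidable using (T?)

-- Residues of Z_p^* are represented by the naturals 1, ..., p-1.
units : ℕ → List ℕ
units p = map suc (upTo (p ∸ 1))

mulMod : (p : ℕ) → .{{NonZero p}} → ℕ → ℕ → ℕ
mulMod p x y = (x * y) % p

powMod : (p : ℕ) → .{{NonZero p}} → ℕ → ℕ → ℕ
powMod p a n = (a ^ n) % p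

hasOrderᵇ : (p : ℕ) → .{{NonZero p}} → ℕ → ℕ → Bool
hasOrderᵇ p a zero = false
hasOrderᵇ p a (suc d) =
  (powMod p a (suc d) ≡ᵇ 1) ∧ all (λ e → not (powMod p a (suc e) ≡ᵇ 1)) (upTo d)

isGenᵇ : (p : ℕ) → .{{NonZero p}} → ℕ → Bool
isGenᵇ p g = hasOrderᵇ p g (p ∸ 1)

isQRᵇ : (p : ℕ) → .{{NonZero p}} → ℕ → Bool
isQRᵇ p r = any (λ x → mulMod p x x ≡ᵇ (r % p)) (units p)

isNGᵇ : (p : ℕ) → .{{NonZero p}} → ℕ → Bool
isNGᵇ p x = not (isQRᵇ p x) ∧ not (isGenᵇ p x)

inRbarᵇ : (p : ℕ) → .{{NonZero p}} → ℕ → ℕ → Bool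
inRbarᵇ p g r = isQRᵇ p r ∧ isNGᵇ p (mulMod p g r)

-- NI(g) = R̄_g ∩ R̄_{g⁻¹}, as a list of residues in 1..p-1;
-- ginv is the inverse of g modulo p (supplied with a proof in the statement).
NI : (p : ℕ) → .{{NonZero p}} → (g ginv : ℕ) → List ℕ
NI p g ginv = filter (λ r → T? (inRbarᵇ p g r ∧ inRbarᵇ p ginv r)) (units p)

aₖ : (p : ℕ) → .{{NonZero p}} → (g ginv k : ℕ) → ℕ
aₖ p g ginv k =
  length (filter (λ r → T? (hasOrderᵇ p r ((p ∸ 1) / 2 ^ k)))
                 (NI p g ginv))
  where instance _ = m^n≢0 2 k

-- Write each unit as g^t with 0 ≤ t < n = p − 1. Then g^t is a square iff t is even, and
-- g^t has order d iff d is the additive order of t modulo n. Multiplying by g and g⁻¹ moves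
-- the exponent to t + 1 and t − 1, which are odd when t is even, so g^t ∈ NI(g) iff t is
-- even and each of t ± 1 is divisible by q₁ or q₂. This forces q₁ ∤ t and q₂ ∤ t (otherwise
-- the other prime divides both neighbours, hence 2), so the order of g^t only sees the
-- 2-part of t: it is n/2^k iff 2^k exactly divides t (k < i), resp. iff 2^i ∣ t (k = i).
-- By the Chinese remainder theorem each count splits into a count modulo 2^i times the
-- number c of admissible residues modulo q₁^j₁ q₂^j₂, giving |NI(g)| = c·2^(i−1),
-- a_k = c·2^(i−1−k) for k < i and a_i = c.

module Submission where

open import Algebra.Properties.CommutativeSemigroup using (x∙yz≈y∙xz)
open import Data.Bool.Base using (Bool; true; false; T; not; _∧_; _∨_)
open import Data.Bool.ListAction using (any)
open import Data.Bool.Properties using (T-≡; T-not-≡; T-∧; T-∨; not-involutive; ∧-identityʳ; ∧-zeroʳ)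
open import Data.Empty using (⊥-elim)
open import Data.List.Base using ([]; _∷_; filter; length; applyUpTo; upTo)
open import Data.List.Properties using (map-upTo)
import Data.List.Relation.Unary.All.Properties as All
import Data.List.Relation.Unary.Any.Properties as Any
open import Data.Nat.Base
open import Data.Nat.Coprimality using (Coprime; coprime-divisor; 1-coprimeTo) renaming (sym to coprime-sym)
open import Data.Nat.Divisibility
open import Data.Nat.DivMod
open import Data.Nat.Primality using (Prime; prime⇒irreducible; prime⇒nonZero; prime⇒nonTrivial; prime[2]; ¬prime[1])
open import Data.Nat.Properties
open import Data.Product.Base using (_×_; _,_; proj₁; proj₂; ∃-syntax)
open import Data.Sum.Base as Sum using (_⊎_; inj₁; inj₂; [_,_]′)
open import Function.Base using (_∘_; id)
open import Function.Bundles using (_⇔_; mk⇔; Equivalence)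
open import Relation.Binary.PropositionalEquality
open import Relation.Nullary.Decidable using (T?; yes; no; isYes; toWitness; fromWitness)
open import Relation.Nullary.Negation using (¬_; contradiction)

open import Defs

+-exchange : ∀ a b c → a + (b + c) ≡ b + (a + c)
+-exchange = x∙yz≈y∙xz +-commutativeSemigroup

*-exchange : ∀ a b c → a * (b * c) ≡ b * (a * c)
*-exchange = x∙yz≈y∙xz *-commutativeSemigroup

T-injective : ∀ {a b} → (T a → T b) → (T b → T a) → a ≡ b
T-injective {false} {false} _ _ = refl
T-injective {false} {true} _ b⇒a = ⊥-elim (b⇒a _)
T-injective {true} {false} a⇒b _ = ⊥-elim (a⇒b _)
T-injective {true} {true} _ _ = refl

T-not⇔¬T : ∀ {b} → T (not b) ⇔ (¬ T b)
T-not⇔¬T {false} = mk⇔ (λ _ ()) (λ _ → _)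
T-not⇔¬T {true} = mk⇔ (λ ()) (λ ¬T → ¬T _)

∧-congˡ-T : ∀ {a b c} → (T a → b ≡ c) → a ∧ b ≡ a ∧ c
∧-congˡ-T {false} _ = refl
∧-congˡ-T {true} b≡c = b≡c _

∧-absorbˡ : ∀ {a b} → (T b → T a) → a ∧ b ≡ b
∧-absorbˡ {true} _ = refl
∧-absorbˡ {false} {false} _ = refl
∧-absorbˡ {false} {true} b⇒a = ⊥-elim (b⇒a _)

≢⇒≡ᵇ-false : ∀ {m n} → m ≢ n → (m ≡ᵇ n) ≡ false
≢⇒≡ᵇ-false {m} {n} m≢n with m ≡ᵇ n in eq
... | false = refl
... | true = contradiction (≡ᵇ⇒≡ m n (Equivalence.from T-≡ eq)) m≢n

not-≡ᵇ⇒≢ : ∀ {m n} → T (not (m ≡ᵇ n)) → m ≢ n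
not-≡ᵇ⇒≢ {m} h refl = subst (T ∘ not) (Equivalence.to T-≡ (≡⇒≡ᵇ m m refl)) h

≢⇒not-≡ᵇ : ∀ {m n} → m ≢ n → T (not (m ≡ᵇ n))
≢⇒not-≡ᵇ m≢n = Equivalence.from T-not-≡ (≢⇒≡ᵇ-false m≢n)

-- Counting

indicator : Bool → ℕ
indicator true = 1
indicator false = 0

count : (ℕ → Bool) → ℕ → ℕ
count P zero = 0
count P (suc n) = indicator (P n) + count P n

count-cong : ∀ {P Q} n → (∀ x → x < n → P x ≡ Q x) → count P n ≡ count Q n
count-cong zero P≡Q = refl
count-cong (suc n) P≡Q =
  cong₂ _+_ (cong indicator (P≡Q n ≤-refl)) (count-cong n (λ x x<n → P≡Q x (m<n⇒m<1+n x<n)))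

count-≤ : ∀ P n → count P n ≤ n
count-≤ P zero = z≤n
count-≤ P (suc n) with P n
... | true = s≤s (count-≤ P n)
... | false = m≤n⇒m≤1+n (count-≤ P n)

count-true : ∀ n → count (λ _ → true) n ≡ n
count-true zero = refl
count-true (suc n) = cong suc (count-true n)

count-false : ∀ n → count (λ _ → false) n ≡ 0
count-false zero = refl
count-false (suc n) = count-false n

count-+-complement : ∀ P n → count P n + count (not ∘ P) n ≡ n
count-+-complement P zero = refl
count-+-complement P (suc n) with P n
... | true = cong suc (count-+-complement P n)
... | false = trans (+-suc (count P n) _) (cong suc (count-+-complement P n))

count-suc-front : ∀ P n → count P (suc n) ≡ indicator (P 0) + count (P ∘ suc) n
count-suc-front P zero = refl
count-suc-front P (suc n) = begin
  indicator (P (suc n)) + count P (suc n)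
    ≡⟨ cong (indicator (P (suc n)) +_) (count-suc-front P n) ⟩
  indicator (P (suc n)) + (indicator (P 0) + count (P ∘ suc) n)
    ≡⟨ +-exchange (indicator (P (suc n))) (indicator (P 0)) _ ⟩
  indicator (P 0) + (indicator (P (suc n)) + count (P ∘ suc) n) ∎
  where open ≡-Reasoning

count-+ : ∀ P a b → count P (b + a) ≡ count (P ∘ (a +_)) b + count P a
count-+ P a zero = refl
count-+ P a (suc b) = begin
  indicator (P (b + a)) + count P (b + a)
    ≡⟨ cong₂ (λ x y → indicator (P x) + y) (+-comm b a) (count-+ P a b) ⟩
  indicator (P (a + b)) + (count (P ∘ (a +_)) b + count P a)
    ≡⟨ +-assoc (indicator (P (a + b))) _ _ ⟨
  count (P ∘ (a +_)) (suc b) + count P a ∎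
  where open ≡-Reasoning

count-remove : ∀ B m y → y < m → T (B y) →
  suc (count (λ z → B z ∧ not (z ≡ᵇ y)) m) ≡ count B m
count-remove B (suc m) y y<1+m By with m ≟ y
... | yes refl rewrite Equivalence.to T-≡ (≡⇒≡ᵇ m m refl) | Equivalence.to T-≡ By =
  cong suc (count-cong m (λ z z<m →
    trans (cong (λ b → B z ∧ not b) (≢⇒≡ᵇ-false (<⇒≢ z<m))) (∧-identityʳ (B z))))
... | no m≢y rewrite ≢⇒≡ᵇ-false m≢y | ∧-identityʳ (B m) =
  trans (sym (+-suc _ _)) (cong (indicator (B m) +_) (count-remove B m y (≤∧≢⇒< (≤-pred y<1+m) (m≢y ∘ sym)) By))

count-≤-injection : ∀ (f : ℕ → ℕ) n (A B : ℕ → Bool) m →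
  (∀ x → x < n → T (A x) → f x < m × T (B (f x))) →
  (∀ x y → x < n → y < n → T (A x) → T (A y) → f x ≡ f y → x ≡ y) →
  count A n ≤ count B m
count-≤-injection f zero A B m maps inj = z≤n
count-≤-injection f (suc n) A B m maps inj with A n in An
... | false = count-≤-injection f n A B m
                (λ x x<n → maps x (m<n⇒m<1+n x<n))
                (λ x y x<n y<n → inj x y (m<n⇒m<1+n x<n) (m<n⇒m<1+n y<n))
... | true = subst (suc (count A n) ≤_) (count-remove B m (f n) fn<m Bfn) (s≤s rest)
  where
  An′ : T (A n)
  An′ = Equivalence.from T-≡ An
  fn<m : f n < m
  fn<m = proj₁ (maps n ≤-refl An′)
  Bfn : T (B (f n))
  Bfn = proj₂ (maps n ≤-refl An′)
  fx≢fn : ∀ x → x < n → T (A x) → f x ≢ f n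
  fx≢fn x x<n Ax e = <⇒≢ x<n (inj x n (m<n⇒m<1+n x<n) ≤-refl Ax An′ e)
  rest : count A n ≤ count (λ z → B z ∧ not (z ≡ᵇ f n)) m
  rest = count-≤-injection f n A _ m
    (λ x x<n Ax → let fx<m , Bfx = maps x (m<n⇒m<1+n x<n) Ax in
      fx<m , subst T (sym (trans (cong (λ b → B (f x) ∧ not b) (≢⇒≡ᵇ-false (fx≢fn x x<n Ax)))
                                 (∧-identityʳ (B (f x))))) Bfx)
    (λ x y x<n y<n → inj x y (m<n⇒m<1+n x<n) (m<n⇒m<1+n y<n))

count-injective-endo : ∀ (f : ℕ → ℕ) n (A B : ℕ → Bool) →
  (∀ x → x < n → f x < n) →
  (∀ x → x < n → B (f x) ≡ A x) →
  (∀ x y → x < n → y < n → f x ≡ f y → x ≡ y) →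
  count A n ≡ count B n
count-injective-endo f n A B maps B∘f≡A inj = ≤-antisym A≤B B≤A
  where
  A≤B : count A n ≤ count B n
  A≤B = count-≤-injection f n A B n
    (λ x x<n Ax → maps x x<n , subst T (sym (B∘f≡A x x<n)) Ax)
    (λ x y x<n y<n _ _ → inj x y x<n y<n)
  ¬A≤¬B : count (not ∘ A) n ≤ count (not ∘ B) n
  ¬A≤¬B = count-≤-injection f n (not ∘ A) (not ∘ B) n
    (λ x x<n ¬Ax → maps x x<n , subst (T ∘ not) (sym (B∘f≡A x x<n)) ¬Ax)
    (λ x y x<n y<n _ _ → inj x y x<n y<n)
  B≤A : count B n ≤ count A n
  B≤A = +-cancelʳ-≤ (count (not ∘ A) n) _ _ (begin
    count B n + count (not ∘ A) n ≤⟨ +-monoʳ-≤ (count B n) ¬A≤¬B ⟩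
    count B n + count (not ∘ B) n ≡⟨ count-+-complement B n ⟩
    n                             ≡⟨ count-+-complement A n ⟨
    count A n + count (not ∘ A) n ∎)
    where open ≤-Reasoning

count≥n⇒all : ∀ B n → n ≤ count B n → ∀ y → y < n → T (B y)
count≥n⇒all B (suc n) full y y<1+n with B n in Bn
... | false = contradiction full (<⇒≱ (s≤s (count-≤ B n)))
... | true with n ≟ y
...   | yes refl = Equivalence.from T-≡ Bn
...   | no n≢y = count≥n⇒all B n (≤-pred full) y (≤∧≢⇒< (≤-pred y<1+n) (n≢y ∘ sym))

length-filter-applyUpTo : ∀ (P : ℕ → Bool) (f : ℕ → ℕ) n →
  length (filter (T? ∘ P) (applyUpTo f n)) ≡ count (P ∘ f) n
length-filter-applyUpTo P f zero = refl
length-filter-applyUpTo P f (suc n) = trans step (sym (count-suc-front (P ∘ f) n))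
  where
  step : length (filter (T? ∘ P) (applyUpTo f (suc n))) ≡ indicator (P (f 0)) + count (P ∘ f ∘ suc) n
  step with P (f 0)
  ... | true = cong suc (length-filter-applyUpTo P (f ∘ suc) n)
  ... | false = length-filter-applyUpTo P (f ∘ suc) n

filter-∧ : ∀ {A : Set} (P Q : A → Bool) xs →
  filter (T? ∘ Q) (filter (T? ∘ P) xs) ≡ filter (λ x → T? (P x ∧ Q x)) xs
filter-∧ P Q [] = refl
filter-∧ P Q (x ∷ xs) = by-cases (P x) (Q x) refl refl
  where
  by-cases : ∀ b c → P x ≡ b → Q x ≡ c →
    filter (T? ∘ Q) (filter (T? ∘ P) (x ∷ xs)) ≡ filter (λ x → T? (P x ∧ Q x)) (x ∷ xs)
  by-cases true true Px Qx rewrite Px | Qx = cong (x ∷_) (filter-∧ P Q xs)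
  by-cases true false Px Qx rewrite Px | Qx = filter-∧ P Q xs
  by-cases false _ Px Qx rewrite Px = filter-∧ P Q xs

[m+kn]%n≡m : ∀ m k n .{{_ : NonZero n}} → m < n → (m + k * n) % n ≡ m
[m+kn]%n≡m m k n m<n = trans ([m+kn]%n≡m%n m k n) (m<n⇒m%n≡m m<n)

[m+kn]/n≡k : ∀ m k n .{{_ : NonZero n}} → m < n → (m + k * n) / n ≡ k
[m+kn]/n≡k m k n m<n = trans (+-distrib-/-∣ʳ m (n∣m*n k)) (cong₂ _+_ (m<n⇒m/n≡0 m<n) (m*n/n≡m k n))

%≡%⇒∣∸ : ∀ a b d .{{_ : NonZero d}} → a % d ≡ b % d → d ∣ a ∸ b
%≡%⇒∣∸ a b d a%d≡b%d with ≤-total b a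
... | inj₂ a≤b = subst (d ∣_) (sym (m≤n⇒m∸n≡0 a≤b)) (d ∣0)
... | inj₁ b≤a = divides (a / d ∸ b / d) (begin
  a ∸ b                                     ≡⟨ cong₂ _∸_ (m≡m%n+[m/n]*n a d) (m≡m%n+[m/n]*n b d) ⟩
  (a % d + a / d * d) ∸ (b % d + b / d * d) ≡⟨ cong (λ r → (r + a / d * d) ∸ (b % d + b / d * d)) a%d≡b%d ⟩
  (b % d + a / d * d) ∸ (b % d + b / d * d) ≡⟨ [m+n]∸[m+o]≡n∸o (b % d) _ _ ⟩
  a / d * d ∸ b / d * d                     ≡⟨ *-distribʳ-∸ d (a / d) (b / d) ⟨
  (a / d ∸ b / d) * d                       ∎)
  where open ≡-Reasoning

∣∧<⇒≡0 : ∀ {d x} .{{_ : NonZero d}} → d ∣ x → x < d → x ≡ 0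
∣∧<⇒≡0 {d} {x} d∣x x<d = trans (sym (m<n⇒m%n≡m x<d)) (n∣m⇒m%n≡0 x d d∣x)

∣∸∧<⇒≤ : ∀ {d x y} .{{_ : NonZero d}} → d ∣ x ∸ y → x < d → x ≤ y
∣∸∧<⇒≤ {x = x} {y} d∣x∸y x<d = m∸n≡0⇒m≤n (∣∧<⇒≡0 d∣x∸y (≤-<-trans (m∸n≤m x y) x<d))

∣∧∣1+⇒≡1 : ∀ {d x} → d ∣ x → d ∣ 1 + x → d ≡ 1
∣∧∣1+⇒≡1 {d} {x} d∣x d∣1+x = ∣1⇒≡1 (∣m+n∣m⇒∣n (subst (d ∣_) (+-comm 1 x) d∣1+x) d∣x)

m∣m^n : ∀ m {n} → 1 ≤ n → m ∣ m ^ n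
m∣m^n m (s≤s _) = m∣m*n _

m^n∣m^[n+o] : ∀ m n o → m ^ n ∣ m ^ (n + o)
m^n∣m^[n+o] m n o = subst (m ^ n ∣_) (sym (^-distribˡ-+-* m n o)) (m∣m*n (m ^ o))

[m*[n%d]]%d≡[m*n]%d : ∀ m n d .{{_ : NonZero d}} → (m * (n % d)) % d ≡ (m * n) % d
[m*[n%d]]%d≡[m*n]%d m n d = begin
  (m * (n % d)) % d           ≡⟨ %-distribˡ-* m (n % d) d ⟩
  (m % d * (n % d % d)) % d   ≡⟨ cong (λ x → (m % d * x) % d) (m%n%n≡m%n n d) ⟩
  (m % d * (n % d)) % d       ≡⟨ %-distribˡ-* m n d ⟨
  (m * n) % d                 ∎
  where open ≡-Reasoning

[[m%d]*n]%d≡[m*n]%d : ∀ m n d .{{_ : NonZero d}} → (m % d * n) % d ≡ (m * n) % d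
[[m%d]*n]%d≡[m*n]%d m n d = begin
  (m % d * n) % d   ≡⟨ cong (_% d) (*-comm (m % d) n) ⟩
  (n * (m % d)) % d ≡⟨ [m*[n%d]]%d≡[m*n]%d n m d ⟩
  (n * m) % d       ≡⟨ cong (_% d) (*-comm n m) ⟩
  (m * n) % d       ∎
  where open ≡-Reasoning

[m%d]^e%d≡m^e%d : ∀ m e d .{{_ : NonZero d}} → (m % d) ^ e % d ≡ m ^ e % d
[m%d]^e%d≡m^e%d m zero d = refl
[m%d]^e%d≡m^e%d m (suc e) d = begin
  (m % d * (m % d) ^ e) % d         ≡⟨ [[m%d]*n]%d≡[m*n]%d m _ d ⟩
  (m * (m % d) ^ e) % d             ≡⟨ [m*[n%d]]%d≡[m*n]%d m _ d ⟨
  (m * ((m % d) ^ e % d)) % d       ≡⟨ cong (λ x → (m * x) % d) ([m%d]^e%d≡m^e%d m e d) ⟩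
  (m * (m ^ e % d)) % d             ≡⟨ [m*[n%d]]%d≡[m*n]%d m _ d ⟩
  (m * m ^ e) % d                   ∎
  where open ≡-Reasoning

coprime⇒*∣ : ∀ {a b x} → Coprime a b → a ∣ x → b ∣ x → a * b ∣ x
coprime⇒*∣ {a} {b} coprime a∣x (divides c refl) with coprime-divisor coprime (subst (a ∣_) (*-comm c b) a∣x)
... | divides c′ refl = divides c′ (*-assoc c′ a b)

coprime-*ˡ : ∀ {a b c} → Coprime a c → Coprime b c → Coprime (a * b) c
coprime-*ˡ a⊥c b⊥c (d∣ab , d∣c) =
  b⊥c (coprime-divisor (λ (x∣d , x∣a) → a⊥c (x∣a , ∣-trans x∣d d∣c)) d∣ab , d∣c)

coprime-^ˡ : ∀ {a c} j → Coprime a c → Coprime (a ^ j) c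
coprime-^ˡ {c = c} zero _ = 1-coprimeTo c
coprime-^ˡ (suc j) a⊥c = coprime-*ˡ a⊥c (coprime-^ˡ j a⊥c)

prime∤⇒coprime : ∀ {q t} → Prime q → ¬ q ∣ t → Coprime q t
prime∤⇒coprime q-prime q∤t (d∣q , d∣t) with prime⇒irreducible q-prime d∣q
... | inj₁ d≡1 = d≡1
... | inj₂ refl = contradiction d∣t q∤t

odd⇒coprime-2 : ∀ {q} → q % 2 ≡ 1 → Coprime 2 q
odd⇒coprime-2 {q} q%2≡1 = prime∤⇒coprime prime[2] λ 2∣q → 0≢1+n (trans (sym (n∣m⇒m%n≡0 q 2 2∣q)) q%2≡1)

coprime-∣ʳ : ∀ {a b c} → Coprime a b → c ∣ b → Coprime a c
coprime-∣ʳ a⊥b c∣b (d∣a , d∣c) = a⊥b (d∣a , ∣-trans d∣c c∣b)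

count-∧-const : ∀ Q b n → count (λ z → Q z ∧ b) n ≡ indicator b * count Q n
count-∧-const Q true n = trans (count-cong n (λ z _ → ∧-identityʳ (Q z))) (sym (+-identityʳ (count Q n)))
count-∧-const Q false n = trans (count-cong n (λ z _ → ∧-zeroʳ (Q z))) (count-false n)

count-product : ∀ N .{{_ : NonZero N}} (Q P : ℕ → Bool) m →
  count (λ z → Q (z % N) ∧ P (z / N)) (m * N) ≡ count P m * count Q N
count-product N Q P zero = refl
count-product N Q P (suc m) = begin
  count R (N + m * N)                          ≡⟨ count-+ R (m * N) N ⟩
  count (R ∘ (m * N +_)) N + count R (m * N)   ≡⟨ cong₂ _+_ block (count-product N Q P m) ⟩
  indicator (P m) * count Q N + count P m * count Q N ≡⟨ *-distribʳ-+ (count Q N) (indicator (P m)) _ ⟨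
  count P (suc m) * count Q N                  ∎
  where
  open ≡-Reasoning
  R : ℕ → Bool
  R z = Q (z % N) ∧ P (z / N)
  block : count (R ∘ (m * N +_)) N ≡ indicator (P m) * count Q N
  block = trans (count-cong N (λ z z<N →
      trans (cong R (+-comm (m * N) z))
            (cong₂ (λ a b → Q a ∧ P b) ([m+kn]%n≡m z m N z<N) ([m+kn]/n≡k z m N z<N))))
    (count-∧-const Q (P m) N)

count-crt : ∀ N m .{{_ : NonZero N}} .{{_ : NonZero m}} (Q P : ℕ → Bool) →
  (∀ x → Q x ≡ Q (x % N)) → (∀ x → P x ≡ P (x % m)) → Coprime N m →
  count (λ t → Q t ∧ P t) (m * N) ≡ count P m * count Q N
count-crt N m Q P Q-periodic P-periodic coprime =
  trans (count-injective-endo f (m * N) _ (λ z → Q (z % N) ∧ P (z / N)) f<mN R∘f inj)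
        (count-product N Q P m)
  where
  f : ℕ → ℕ
  f t = t % N + (t % m) * N
  f%N : ∀ t → f t % N ≡ t % N
  f%N t = [m+kn]%n≡m (t % N) (t % m) N (m%n<n t N)
  f/N : ∀ t → f t / N ≡ t % m
  f/N t = [m+kn]/n≡k (t % N) (t % m) N (m%n<n t N)
  f<mN : ∀ t → t < m * N → f t < m * N
  f<mN t _ = begin-strict
    t % N + (t % m) * N <⟨ +-monoˡ-< ((t % m) * N) (m%n<n t N) ⟩
    suc (t % m) * N     ≤⟨ *-monoˡ-≤ N (m%n<n t m) ⟩
    m * N               ∎
    where open ≤-Reasoning
  R∘f : ∀ t → t < m * N → (Q (f t % N) ∧ P (f t / N)) ≡ (Q t ∧ P t)
  R∘f t _ = cong₂ _∧_ (trans (cong Q (f%N t)) (sym (Q-periodic t)))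
                      (trans (cong P (f/N t)) (sym (P-periodic t)))
  instance _ = m*n≢0 N m
  ≤-of-f≡ : ∀ x y → x < m * N → f x ≡ f y → x ≤ y
  ≤-of-f≡ x y x<mN fx≡fy = ∣∸∧<⇒≤ {N * m} N*m∣x∸y (subst (x <_) (*-comm m N) x<mN)
    where
    N*m∣x∸y : N * m ∣ x ∸ y
    N*m∣x∸y = coprime⇒*∣ coprime
      (%≡%⇒∣∸ x y N (trans (sym (f%N x)) (trans (cong (_% N) fx≡fy) (f%N y))))
      (%≡%⇒∣∸ x y m (trans (sym (f/N x)) (trans (cong (_/ N) fx≡fy) (f/N y))))
  inj : ∀ x y → x < m * N → y < m * N → f x ≡ f y → x ≡ y
  inj x y x< y< fx≡fy = ≤-antisym (≤-of-f≡ x y x< fx≡fy) (≤-of-f≡ y x y< (sym fx≡fy))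

infix 7 _∣ᵇ_
_∣ᵇ_ : ℕ → ℕ → Bool
d ∣ᵇ u = isYes (d ∣? u)

∣ᵇ⇒∣ : ∀ {d u} → T (d ∣ᵇ u) → d ∣ u
∣ᵇ⇒∣ = toWitness

∣⇒∣ᵇ : ∀ {d u} → d ∣ u → T (d ∣ᵇ u)
∣⇒∣ᵇ = fromWitness

∤⇒∣ᵇ≡false : ∀ {d u} → ¬ d ∣ u → d ∣ᵇ u ≡ false
∤⇒∣ᵇ≡false d∤u = Equivalence.to T-not-≡ (Equivalence.from T-not⇔¬T (d∤u ∘ ∣ᵇ⇒∣))

∣ᵇ-cong-% : ∀ {d N} .{{_ : NonZero N}} → d ∣ N → ∀ t → d ∣ᵇ t ≡ d ∣ᵇ (t % N)
∣ᵇ-cong-% d∣N t = T-injective (λ d∣t → ∣⇒∣ᵇ (%-presˡ-∣ (∣ᵇ⇒∣ d∣t) d∣N))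
                              (λ d∣t%N → ∣⇒∣ᵇ (∣n∣m%n⇒∣m d∣N (∣ᵇ⇒∣ d∣t%N)))

count-multiples : ∀ d .{{_ : NonZero d}} (R : ℕ → Bool) b →
  count (λ u → d ∣ᵇ u ∧ R (u / d)) (b * d) ≡ count R b
count-multiples d R b = begin
  count (λ u → d ∣ᵇ u ∧ R (u / d)) (b * d)        ≡⟨ count-cong (b * d) (λ u _ → cong (_∧ R (u / d)) (∣ᵇ≡%≡ᵇ0 u)) ⟩
  count (λ u → (u % d ≡ᵇ 0) ∧ R (u / d)) (b * d)  ≡⟨ count-product d (_≡ᵇ 0) R b ⟩
  count R b * count (_≡ᵇ 0) d                     ≡⟨ cong (count R b *_) (count-≡ᵇ0 d) ⟩
  count R b * 1                                   ≡⟨ *-identityʳ (count R b) ⟩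
  count R b                                       ∎
  where
  open ≡-Reasoning
  ∣ᵇ≡%≡ᵇ0 : ∀ u → d ∣ᵇ u ≡ (u % d ≡ᵇ 0)
  ∣ᵇ≡%≡ᵇ0 u = T-injective (λ d∣u → ≡⇒≡ᵇ _ 0 (n∣m⇒m%n≡0 u d (∣ᵇ⇒∣ d∣u)))
                          (λ u%d≡0 → ∣⇒∣ᵇ (m%n≡0⇒n∣m u d (≡ᵇ⇒≡ _ 0 u%d≡0)))
  count-≡ᵇ0 : ∀ d .{{_ : NonZero d}} → count (_≡ᵇ 0) d ≡ 1
  count-≡ᵇ0 (suc d) = trans (count-suc-front (_≡ᵇ 0) d) (cong suc (count-false d))

count-∣ᵇ : ∀ d .{{_ : NonZero d}} b → count (d ∣ᵇ_) (b * d) ≡ b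
count-∣ᵇ d b = begin
  count (d ∣ᵇ_) (b * d)                        ≡⟨ count-cong (b * d) (λ u _ → sym (∧-identityʳ (d ∣ᵇ u))) ⟩
  count (λ u → d ∣ᵇ u ∧ true) (b * d)          ≡⟨ count-multiples d (λ _ → true) b ⟩
  count (λ _ → true) b                         ≡⟨ count-true b ⟩
  b                                            ∎
  where open ≡-Reasoning

count-odd : ∀ b → count (not ∘ (2 ∣ᵇ_)) (b * 2) ≡ b
count-odd b = +-cancelˡ-≡ b _ _ (begin
  b + count (not ∘ (2 ∣ᵇ_)) (b * 2)                    ≡⟨ cong (_+ count (not ∘ (2 ∣ᵇ_)) (b * 2)) (count-∣ᵇ 2 b) ⟨
  count (2 ∣ᵇ_) (b * 2) + count (not ∘ (2 ∣ᵇ_)) (b * 2) ≡⟨ count-+-complement (2 ∣ᵇ_) (b * 2) ⟩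
  b * 2                                                ≡⟨ *-comm b 2 ⟩
  b + (b + 0)                                          ≡⟨ cong (b +_) (+-identityʳ b) ⟩
  b + b                                                ∎)
  where open ≡-Reasoning

2^_∥ᵇ_ : ℕ → ℕ → Bool
2^ k ∥ᵇ u = 2 ^ k ∣ᵇ u ∧ not (2 ^ suc k ∣ᵇ u)

count-2^∥ᵇ : ∀ k b → count (2^ k ∥ᵇ_) (b * 2 * 2 ^ k) ≡ b
count-2^∥ᵇ k b = begin
  count (2^ k ∥ᵇ_) (b * 2 * 2 ^ k)                                ≡⟨ count-cong (b * 2 * 2 ^ k) (λ u _ → exact⇔quotient-odd u) ⟩
  count (λ u → 2 ^ k ∣ᵇ u ∧ not (2 ∣ᵇ (u / 2 ^ k))) (b * 2 * 2 ^ k) ≡⟨ count-multiples (2 ^ k) (not ∘ (2 ∣ᵇ_)) (b * 2) ⟩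
  count (not ∘ (2 ∣ᵇ_)) (b * 2)                                   ≡⟨ count-odd b ⟩
  b                                                               ∎
  where
  open ≡-Reasoning
  instance _ = m^n≢0 2 k
  exact⇔quotient-odd : ∀ u → 2^ k ∥ᵇ u ≡ (2 ^ k ∣ᵇ u ∧ not (2 ∣ᵇ (u / 2 ^ k)))
  exact⇔quotient-odd u with 2 ^ k ∣ᵇ u in 2^k∣u
  ... | false = refl
  ... | true = cong not (T-injective
        (λ 2^1+k∣u → ∣⇒∣ᵇ (*-cancelʳ-∣ (2 ^ k) (subst (2 * 2 ^ k ∣_) u≡ (∣ᵇ⇒∣ 2^1+k∣u))))
        (λ 2∣u/2^k → ∣⇒∣ᵇ (subst (2 * 2 ^ k ∣_) (sym u≡) (*-monoˡ-∣ (2 ^ k) (∣ᵇ⇒∣ 2∣u/2^k)))))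
    where
    u≡ : u ≡ u / 2 ^ k * 2 ^ k
    u≡ = sym (m/n*n≡m (∣ᵇ⇒∣ (Equivalence.from T-≡ 2^k∣u)))

-- Orders

IsAdditiveOrder : ℕ → ℕ → ℕ → Set
IsAdditiveOrder n t d = 0 < d × n ∣ t * d × (∀ e → 0 < e → e < d → ¬ n ∣ t * e)

isAdditiveOrder : ∀ {n t c d u} .{{_ : NonZero c}} → n ≡ c * d → t ≡ u * c →
  0 < d → Coprime d u → IsAdditiveOrder n t d
isAdditiveOrder {c = c} {d} {u} refl refl 0<d d⊥u = 0<d , n∣td , minimal
  where
  n∣td : c * d ∣ u * c * d
  n∣td = divides u (*-assoc u c d)
  minimal : ∀ e → 0 < e → e < d → ¬ c * d ∣ u * c * e
  minimal e 0<e e<d n∣uce = <⇒≱ e<d (∣⇒≤ {{>-nonZero 0<e}} d∣e)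
    where
    d∣e : d ∣ e
    d∣e = coprime-divisor d⊥u (*-cancelˡ-∣ c (subst (c * d ∣_) (trans (*-assoc u c e) (*-exchange u c e)) n∣uce))

additiveOrder⇒cofactor∣ : ∀ {n t c d} → n ≡ c * d → IsAdditiveOrder n t d → c ∣ t
additiveOrder⇒cofactor∣ {d = d} refl (0<d , cd∣td , _) =
  *-cancelʳ-∣ d {{>-nonZero 0<d}} cd∣td

additiveOrder⇒cofactor*∤ : ∀ {n t c e d} → n ≡ c * (e * d) → 1 < e →
  IsAdditiveOrder n t (e * d) → ¬ c * e ∣ t
additiveOrder⇒cofactor*∤ {c = c} {e} {d} refl 1<e (0<ed , _ , minimal) (divides a refl) =
  minimal d 0<d d<ed (divides a (begin
    a * (c * e) * d ≡⟨ *-assoc a (c * e) d ⟩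
    a * (c * e * d) ≡⟨ cong (a *_) (*-assoc c e d) ⟩
    a * (c * (e * d)) ∎))
  where
  open ≡-Reasoning
  instance _ = >-nonZero 0<ed
  0<d : 0 < d
  0<d = >-nonZero⁻¹ d {{m*n≢0⇒n≢0 e}}
  d<ed : d < e * d
  d<ed = subst (d <_) (*-comm d e) (m<m*n d e {{m*n≢0⇒n≢0 e}} 1<e)

HasOrder : (p : ℕ) → .{{NonZero p}} → ℕ → ℕ → Set
HasOrder p a d = 0 < d × powMod p a d ≡ 1 × (∀ e → 0 < e → e < d → powMod p a e ≢ 1)

hasOrderᵇ⇔HasOrder : ∀ p .{{_ : NonZero p}} a d → T (hasOrderᵇ p a d) ⇔ HasOrder p a d
hasOrderᵇ⇔HasOrder p a zero = mk⇔ (λ ()) (λ ())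
hasOrderᵇ⇔HasOrder p a (suc d) = mk⇔ to from
  where
  a^1+_≢1 : ℕ → Bool
  a^1+ e ≢1 = not (powMod p a (suc e) ≡ᵇ 1)
  to : T (hasOrderᵇ p a (suc d)) → HasOrder p a (suc d)
  to h with Equivalence.to T-∧ h
  ... | a^d≡1 , minimal = z<s , ≡ᵇ⇒≡ _ 1 a^d≡1 , λ where
    (suc e) _ (s≤s e<d) → not-≡ᵇ⇒≢ (All.applyUpTo⁻ id d (All.all⁺ a^1+_≢1 (upTo d) minimal) e<d)
  from : HasOrder p a (suc d) → T (hasOrderᵇ p a (suc d))
  from (_ , a^d≡1 , minimal) = Equivalence.from T-∧
    (≡⇒≡ᵇ _ 1 a^d≡1 , All.all⁻ a^1+_≢1 (All.applyUpTo⁺₁ id d (λ {e} e<d → ≢⇒not-≡ᵇ (minimal (suc e) z<s (s≤s e<d)))))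

-- Discrete logarithms

module DiscreteLog (p : ℕ) .{{_ : NonZero p}} (1<p : 1 < p) (g : ℕ) (g-generator : T (isGenᵇ p g)) where

  n : ℕ
  n = p ∸ 1

  1+n≡p : suc n ≡ p
  1+n≡p = m+[n∸m]≡n (<⇒≤ 1<p)

  instance
    n≢0 : NonZero n
    n≢0 = >-nonZero (m<n⇒0<n∸m 1<p)

  g^[_] : ℕ → ℕ
  g^[ t ] = g ^ t % p

  g^[+] : ∀ a b → (g^[ a ] * g^[ b ]) % p ≡ g^[ a + b ]
  g^[+] a b = begin
    (g ^ a % p * (g ^ b % p)) % p ≡⟨ [[m%d]*n]%d≡[m*n]%d (g ^ a) _ p ⟩
    (g ^ a * (g ^ b % p)) % p     ≡⟨ [m*[n%d]]%d≡[m*n]%d (g ^ a) (g ^ b) p ⟩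
    (g ^ a * g ^ b) % p           ≡⟨ cong (_% p) (^-distribˡ-+-* g a b) ⟨
    g^[ a + b ]                   ∎
    where open ≡-Reasoning

  powMod-g^[] : ∀ t e → powMod p g^[ t ] e ≡ g^[ t * e ]
  powMod-g^[] t e = trans ([m%d]^e%d≡m^e%d (g ^ t) e p) (cong (_% p) (^-*-assoc g t e))

  g-order : HasOrder p g n
  g-order = Equivalence.to (hasOrderᵇ⇔HasOrder p g n) g-generator

  g^[n]≡1 : g^[ n ] ≡ 1
  g^[n]≡1 = proj₁ (proj₂ g-order)

  g^[+n] : ∀ a → g^[ a + n ] ≡ g^[ a ]
  g^[+n] a = begin
    g^[ a + n ]               ≡⟨ g^[+] a n ⟨
    (g^[ a ] * g^[ n ]) % p   ≡⟨ cong (λ x → (g^[ a ] * x) % p) g^[n]≡1 ⟩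
    (g^[ a ] * 1) % p         ≡⟨ cong (_% p) (*-identityʳ g^[ a ]) ⟩
    g^[ a ] % p               ≡⟨ m%n%n≡m%n (g ^ a) p ⟩
    g^[ a ]                   ∎
    where open ≡-Reasoning

  g^[+kn] : ∀ a k → g^[ a + k * n ] ≡ g^[ a ]
  g^[+kn] a zero = cong g^[_] (+-identityʳ a)
  g^[+kn] a (suc k) = begin
    g^[ a + (n + k * n) ] ≡⟨ cong g^[_] (trans (cong (a +_) (+-comm n (k * n))) (sym (+-assoc a (k * n) n))) ⟩
    g^[ a + k * n + n ]   ≡⟨ g^[+n] (a + k * n) ⟩
    g^[ a + k * n ]       ≡⟨ g^[+kn] a k ⟩
    g^[ a ]               ∎
    where open ≡-Reasoning

  g^[%n] : ∀ a → g^[ a ] ≡ g^[ a % n ]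
  g^[%n] a = trans (cong g^[_] (m≡m%n+[m/n]*n a n)) (g^[+kn] (a % n) (a / n))

  g^[]≡1⇒n∣ : ∀ x → g^[ x ] ≡ 1 → n ∣ x
  g^[]≡1⇒n∣ x g^[x]≡1 with x % n in x%n≡r | m%n<n x n
  ... | zero | _ = m%n≡0⇒n∣m x n x%n≡r
  ... | suc r | r<n = contradiction g^[r]≡1 (proj₂ (proj₂ g-order) (suc r) z<s r<n)
    where
    g^[r]≡1 : g^[ suc r ] ≡ 1
    g^[r]≡1 = trans (cong g^[_] (sym x%n≡r)) (trans (sym (g^[%n] x)) g^[x]≡1)

  n∣⇒g^[]≡1 : ∀ x → n ∣ x → g^[ x ] ≡ 1
  n∣⇒g^[]≡1 x n∣x = begin
    g^[ x ]     ≡⟨ g^[%n] x ⟩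
    g^[ x % n ] ≡⟨ cong g^[_] (n∣m⇒m%n≡0 x n n∣x) ⟩
    1 % p       ≡⟨ m<n⇒m%n≡m 1<p ⟩
    1           ∎
    where open ≡-Reasoning

  0<g^[] : ∀ t → 0 < g^[ t ]
  0<g^[] t = n≢0⇒n>0 λ g^[t]≡0 → 0≢1+n (begin
    0                      ≡⟨ m<n⇒m%n≡m (>-nonZero⁻¹ p) ⟨
    0 % p                  ≡⟨ cong (_% p) (0^n≡0 n) ⟨
    0 ^ n % p              ≡⟨ cong (λ x → x ^ n % p) g^[t]≡0 ⟨
    powMod p g^[ t ] n     ≡⟨ powMod-g^[] t n ⟩
    g^[ t * n ]            ≡⟨ n∣⇒g^[]≡1 (t * n) (n∣m*n t) ⟩
    1                      ∎)
    where
    open ≡-Reasoning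
    0^n≡0 : ∀ m .{{_ : NonZero m}} → 0 ^ m ≡ 0
    0^n≡0 (suc m) = refl

  g^[]<p : ∀ t → g^[ t ] < p
  g^[]<p t = m%n<n (g ^ t) p

  g^[]≡⇒≤ : ∀ {a b} → a < n → b ≤ a → g^[ a ] ≡ g^[ b ] → a ≤ b
  g^[]≡⇒≤ {a} {b} a<n b≤a g^[a]≡g^[b] = ∣∸∧<⇒≤ (g^[]≡1⇒n∣ (a ∸ b) g^[a∸b]≡1) a<n
    where
    b≤n : b ≤ n
    b≤n = ≤-trans b≤a (<⇒≤ a<n)
    shift : a ∸ b + n ≡ a + (n ∸ b)
    shift = begin
      a ∸ b + n             ≡⟨ cong (a ∸ b +_) (m+[n∸m]≡n b≤n) ⟨
      a ∸ b + (b + (n ∸ b)) ≡⟨ +-assoc (a ∸ b) b (n ∸ b) ⟨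
      a ∸ b + b + (n ∸ b)   ≡⟨ cong (_+ (n ∸ b)) (m∸n+n≡m b≤a) ⟩
      a + (n ∸ b)           ∎
      where open ≡-Reasoning
    g^[a∸b]≡1 : g^[ a ∸ b ] ≡ 1
    g^[a∸b]≡1 = begin
      g^[ a ∸ b ]                   ≡⟨ g^[+n] (a ∸ b) ⟨
      g^[ a ∸ b + n ]               ≡⟨ cong g^[_] shift ⟩
      g^[ a + (n ∸ b) ]             ≡⟨ g^[+] a (n ∸ b) ⟨
      (g^[ a ] * g^[ n ∸ b ]) % p   ≡⟨ cong (λ x → (x * g^[ n ∸ b ]) % p) g^[a]≡g^[b] ⟩
      (g^[ b ] * g^[ n ∸ b ]) % p   ≡⟨ g^[+] b (n ∸ b) ⟩
      g^[ b + (n ∸ b) ]             ≡⟨ cong g^[_] (m+[n∸m]≡n b≤n) ⟩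
      g^[ n ]                       ≡⟨ g^[n]≡1 ⟩
      1                             ∎
      where open ≡-Reasoning

  g^[]-injective : ∀ {a b} → a < n → b < n → g^[ a ] ≡ g^[ b ] → a ≡ b
  g^[]-injective {a} {b} a<n b<n eq with ≤-total b a
  ... | inj₁ b≤a = ≤-antisym (g^[]≡⇒≤ a<n b≤a eq) b≤a
  ... | inj₂ a≤b = ≤-antisym a≤b (g^[]≡⇒≤ b<n a≤b (sym eq))

  g^[]≡⇒%≡ : ∀ a b → g^[ a ] ≡ g^[ b ] → a % n ≡ b % n
  g^[]≡⇒%≡ a b eq = g^[]-injective (m%n<n a n) (m%n<n b n) (trans (sym (g^[%n] a)) (trans eq (g^[%n] b)))

  1+pred-g^[] : ∀ t → suc (pred g^[ t ]) ≡ g^[ t ]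
  1+pred-g^[] t = suc-pred g^[ t ] {{>-nonZero (0<g^[] t)}}

  pred-g^[]<n : ∀ t → pred g^[ t ] < n
  pred-g^[]<n t = s≤s⁻¹ (subst₂ _<_ (sym (1+pred-g^[] t)) (sym 1+n≡p) (g^[]<p t))

  pred-g^[]-injective : ∀ a b → a < n → b < n → pred g^[ a ] ≡ pred g^[ b ] → a ≡ b
  pred-g^[]-injective a b a<n b<n eq =
    g^[]-injective a<n b<n (trans (sym (1+pred-g^[] a)) (trans (cong suc eq) (1+pred-g^[] b)))

  isPowerᵇ : ℕ → Bool
  isPowerᵇ y = any (λ s → g^[ s ] ≡ᵇ y) (upTo n)

  every-unit-isPower : ∀ y → y < n → T (isPowerᵇ (suc y))
  every-unit-isPower = count≥n⇒all (isPowerᵇ ∘ suc) n (≤-reflexive (trans (sym (count-true n))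
    (count-injective-endo (pred ∘ g^[_]) n (λ _ → true) (isPowerᵇ ∘ suc) (λ t _ → pred-g^[]<n t)
      g^[]-isPower pred-g^[]-injective)))
    where
    g^[]-isPower : ∀ t → t < n → isPowerᵇ (suc (pred g^[ t ])) ≡ true
    g^[]-isPower t t<n = Equivalence.to T-≡ (subst (T ∘ isPowerᵇ) (sym (1+pred-g^[] t))
      (Any.any⁺ _ (Any.applyUpTo⁺ id (≡⇒≡ᵇ g^[ t ] g^[ t ] refl) t<n)))

  g^[]-surjective : ∀ y → 0 < y → y < p → ∃[ s ] s < n × g^[ s ] ≡ y
  g^[]-surjective (suc y) _ 1+y<p
    with Any.applyUpTo⁻ id (Any.any⁻ _ (upTo n) (every-unit-isPower y (s≤s⁻¹ (subst (suc y <_) (sym 1+n≡p) 1+y<p))))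
  ... | s , s<n , g^[s]≡1+y = s , s<n , ≡ᵇ⇒≡ _ _ g^[s]≡1+y

  count-units : ∀ (F : ℕ → Bool) → length (filter (T? ∘ F) (units p)) ≡ count (F ∘ g^[_]) n
  count-units F = begin
    length (filter (T? ∘ F) (units p))         ≡⟨ cong (length ∘ filter (T? ∘ F)) (map-upTo suc n) ⟩
    length (filter (T? ∘ F) (applyUpTo suc n)) ≡⟨ length-filter-applyUpTo F suc n ⟩
    count (F ∘ suc) n                          ≡⟨ count-injective-endo (pred ∘ g^[_]) n (F ∘ g^[_]) (F ∘ suc)
                                                    (λ t _ → pred-g^[]<n t) (λ t _ → cong F (1+pred-g^[] t))
                                                    pred-g^[]-injective ⟨
    count (F ∘ g^[_]) n                        ∎
    where open ≡-Reasoning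

  isQR-g^[] : 2 ∣ n → ∀ t → isQRᵇ p g^[ t ] ≡ 2 ∣ᵇ t
  isQR-g^[] 2∣n t = T-injective (∣⇒∣ᵇ ∘ square⇒even) (even⇒square ∘ ∣ᵇ⇒∣)
    where
    square? : ℕ → Bool
    square? x = mulMod p x x ≡ᵇ (g^[ t ] % p)
    square⇒even : T (isQRᵇ p g^[ t ]) → 2 ∣ t
    square⇒even qr with Any.applyUpTo⁻ id (Any.map⁻ (Any.any⁻ square? (units p) qr))
    ... | x , x<n , x²≡g^[t] with g^[]-surjective (suc x) z<s (subst (suc x <_) 1+n≡p (s<s x<n))
    ... | s , _ , g^[s]≡1+x = ∣n∣m%n⇒∣m 2∣n (subst (2 ∣_) (g^[]≡⇒%≡ (s + s) t g^[2s]≡g^[t]) (%-presˡ-∣ 2∣2s 2∣n))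
      where
      2∣2s : 2 ∣ s + s
      2∣2s = divides s (trans (cong (s +_) (sym (+-identityʳ s))) (*-comm 2 s))
      g^[2s]≡g^[t] : g^[ s + s ] ≡ g^[ t ]
      g^[2s]≡g^[t] = begin
        g^[ s + s ]                 ≡⟨ g^[+] s s ⟨
        (g^[ s ] * g^[ s ]) % p     ≡⟨ cong (λ y → (y * y) % p) g^[s]≡1+x ⟩
        mulMod p (suc x) (suc x)    ≡⟨ ≡ᵇ⇒≡ _ _ x²≡g^[t] ⟩
        g^[ t ] % p                 ≡⟨ m%n%n≡m%n (g ^ t) p ⟩
        g^[ t ]                     ∎
        where open ≡-Reasoning
    even⇒square : 2 ∣ t → T (isQRᵇ p g^[ t ])
    even⇒square (divides c refl) = Any.any⁺ square? (Any.map⁺ (Any.applyUpTo⁺ id g^[c]²≡g^[t] (pred-g^[]<n c)))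
      where
      g^[c]²≡g^[t] : T (square? (suc (pred g^[ c ])))
      g^[c]²≡g^[t] = ≡⇒≡ᵇ _ _ (begin
        mulMod p (suc (pred g^[ c ])) (suc (pred g^[ c ])) ≡⟨ cong (λ y → mulMod p y y) (1+pred-g^[] c) ⟩
        (g^[ c ] * g^[ c ]) % p                           ≡⟨ g^[+] c c ⟩
        g^[ c + c ]                                       ≡⟨ cong g^[_] (trans (cong (c +_) (sym (+-identityʳ c))) (*-comm 2 c)) ⟩
        g^[ c * 2 ]                                       ≡⟨ m%n%n≡m%n (g ^ (c * 2)) p ⟨
        g^[ c * 2 ] % p                                   ∎)
        where open ≡-Reasoning

  g*g^[] : ∀ t → mulMod p g g^[ t ] ≡ g^[ suc t ]
  g*g^[] t = [m*[n%d]]%d≡[m*n]%d g (g ^ t) p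

  ginv*g^[] : ∀ ginv → (g * ginv) % p ≡ 1 → ∀ t → mulMod p ginv g^[ t ] ≡ g^[ (n ∸ 1) + t ]
  ginv*g^[] ginv g*ginv≡1 t = begin
    (ginv * g^[ t ]) % p                     ≡⟨ cong (λ x → (ginv * x) % p) (trans (sym (g^[+n] t)) (cong g^[_] t+n≡1+s)) ⟩
    (ginv * g^[ suc s ]) % p                 ≡⟨ [m*[n%d]]%d≡[m*n]%d ginv (g * g ^ s) p ⟩
    (ginv * (g * g ^ s)) % p                 ≡⟨ cong (_% p) (trans (sym (*-assoc ginv g (g ^ s))) (cong (_* g ^ s) (*-comm ginv g))) ⟩
    (g * ginv * g ^ s) % p                   ≡⟨ [[m%d]*n]%d≡[m*n]%d (g * ginv) (g ^ s) p ⟨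
    ((g * ginv) % p * g ^ s) % p             ≡⟨ cong (λ x → (x * g ^ s) % p) g*ginv≡1 ⟩
    (1 * g ^ s) % p                          ≡⟨ cong (_% p) (*-identityˡ (g ^ s)) ⟩
    g^[ s ]                                  ∎
    where
    open ≡-Reasoning
    s : ℕ
    s = (n ∸ 1) + t
    t+n≡1+s : t + n ≡ suc s
    t+n≡1+s = trans (+-comm t n) (cong (_+ t) (sym (m+[n∸m]≡n (>-nonZero⁻¹ n))))

  hasOrder-g^[]⇔ : ∀ t d → T (hasOrderᵇ p g^[ t ] d) ⇔ IsAdditiveOrder n t d
  hasOrder-g^[]⇔ t d = mk⇔
    (λ o → let 0<d , g^[td]≡1 , minimal = Equivalence.to (hasOrderᵇ⇔HasOrder p g^[ t ] d) o in
      0<d , g^[]≡1⇒n∣ (t * d) (trans (sym (powMod-g^[] t d)) g^[td]≡1) ,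
      λ e 0<e e<d n∣te → minimal e 0<e e<d (trans (powMod-g^[] t e) (n∣⇒g^[]≡1 (t * e) n∣te)))
    (λ (0<d , n∣td , minimal) → Equivalence.from (hasOrderᵇ⇔HasOrder p g^[ t ] d)
      (0<d , trans (powMod-g^[] t d) (n∣⇒g^[]≡1 (t * d) n∣td) ,
      λ e 0<e e<d g^[te]≡1 → minimal e 0<e e<d (g^[]≡1⇒n∣ (t * e) (trans (sym (powMod-g^[] t e)) g^[te]≡1))))

-- The setting of the theorem

module TwoOddPrimes (p i j₁ j₂ q₁ q₂ : ℕ) .{{_ : NonZero p}}
  (p-prime : Prime p) (q₁-prime : Prime q₁) (q₂-prime : Prime q₂)
  (q₁-odd : q₁ % 2 ≡ 1) (q₂-odd : q₂ % 2 ≡ 1) (1≤i : 1 ≤ i) (1≤j₁ : 1 ≤ j₁) (1≤j₂ : 1 ≤ j₂)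
  (p∸1≡ : p ∸ 1 ≡ 2 ^ i * q₁ ^ j₁ * q₂ ^ j₂)
  (g ginv : ℕ) (g-generator : T (isGenᵇ p g)) (g*ginv≡1 : (g * ginv) % p ≡ 1) where

  open DiscreteLog p (nonTrivial⇒n>1 p {{prime⇒nonTrivial p-prime}}) g g-generator public

  N m : ℕ
  N = 2 ^ i
  m = q₁ ^ j₁ * q₂ ^ j₂

  instance
    q₁≢0 : NonZero q₁
    q₁≢0 = prime⇒nonZero q₁-prime
    q₂≢0 : NonZero q₂
    q₂≢0 = prime⇒nonZero q₂-prime
    N≢0 : NonZero N
    N≢0 = m^n≢0 2 i
    m≢0 : NonZero m
    m≢0 = m*n≢0 (q₁ ^ j₁) (q₂ ^ j₂) {{m^n≢0 q₁ j₁}} {{m^n≢0 q₂ j₂}}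

  n≡N*m : n ≡ N * m
  n≡N*m = trans p∸1≡ (*-assoc N (q₁ ^ j₁) (q₂ ^ j₂))

  2∣N : 2 ∣ N
  2∣N = m∣m^n 2 1≤i

  q₁∣m : q₁ ∣ m
  q₁∣m = ∣m⇒∣m*n (q₂ ^ j₂) (m∣m^n q₁ 1≤j₁)

  q₂∣m : q₂ ∣ m
  q₂∣m = ∣n⇒∣m*n (q₁ ^ j₁) (m∣m^n q₂ 1≤j₂)

  N∣n : N ∣ n
  N∣n = subst (N ∣_) (sym n≡N*m) (m∣m*n m)

  m∣n : m ∣ n
  m∣n = subst (m ∣_) (sym n≡N*m) (n∣m*n N)

  N⊥m : Coprime N m
  N⊥m = coprime-^ˡ i (coprime-sym (coprime-*ˡ (coprime-^ˡ j₁ (coprime-sym (odd⇒coprime-2 q₁-odd)))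
                                             (coprime-^ˡ j₂ (coprime-sym (odd⇒coprime-2 q₂-odd)))))

  coprime-m : ∀ {u} → ¬ q₁ ∣ u → ¬ q₂ ∣ u → Coprime m u
  coprime-m q₁∤u q₂∤u = coprime-*ˡ (coprime-^ˡ j₁ (prime∤⇒coprime q₁-prime q₁∤u))
                                  (coprime-^ˡ j₂ (prime∤⇒coprime q₂-prime q₂∤u))

  sharesFactorᵇ : ℕ → Bool
  sharesFactorᵇ s = q₁ ∣ᵇ s ∨ q₂ ∣ᵇ s

  isGen-g^[]-odd : ∀ s → ¬ 2 ∣ s → isGenᵇ p g^[ s ] ≡ not (sharesFactorᵇ s)
  isGen-g^[]-odd s 2∤s = T-injective generator⇒¬shares ¬shares⇒generator
    where
    generator⇒∤ : ∀ {q} → Prime q → q ∣ n → IsAdditiveOrder n s n → ¬ q ∣ s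
    generator⇒∤ {q} q-prime (divides b n≡b*q) order q∣s =
      additiveOrder⇒cofactor*∤ {c = 1} (trans n≡q*b (sym (*-identityˡ (q * b)))) (nonTrivial⇒n>1 q {{prime⇒nonTrivial q-prime}})
        (subst (IsAdditiveOrder n s) n≡q*b order) (subst (_∣ s) (sym (*-identityˡ q)) q∣s)
      where
      n≡q*b : n ≡ q * b
      n≡q*b = trans n≡b*q (*-comm b q)
    generator⇒¬shares : T (isGenᵇ p g^[ s ]) → T (not (sharesFactorᵇ s))
    generator⇒¬shares gen = Equivalence.from T-not⇔¬T ([ q∤ q₁-prime q₁∣m , q∤ q₂-prime q₂∣m ]′ ∘ Equivalence.to T-∨)
      where
      q∤ : ∀ {q} → Prime q → q ∣ m → ¬ T (q ∣ᵇ s)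
      q∤ q-prime q∣m = generator⇒∤ q-prime (∣-trans q∣m m∣n) (Equivalence.to (hasOrder-g^[]⇔ s n) gen) ∘ ∣ᵇ⇒∣
    ¬shares⇒generator : T (not (sharesFactorᵇ s)) → T (isGenᵇ p g^[ s ])
    ¬shares⇒generator ¬shares = Equivalence.from (hasOrder-g^[]⇔ s n)
      (isAdditiveOrder (sym (*-identityˡ n)) (sym (*-identityʳ s)) (>-nonZero⁻¹ n) n⊥s)
      where
      ¬shares′ : ¬ T (sharesFactorᵇ s)
      ¬shares′ = Equivalence.to T-not⇔¬T ¬shares
      n⊥s : Coprime n s
      n⊥s = subst (λ x → Coprime x s) (sym n≡N*m) (coprime-*ˡ (coprime-^ˡ i (prime∤⇒coprime prime[2] 2∤s))
        (coprime-m (¬shares′ ∘ Equivalence.from T-∨ ∘ inj₁ ∘ ∣⇒∣ᵇ) (¬shares′ ∘ Equivalence.from T-∨ ∘ inj₂ ∘ ∣⇒∣ᵇ)))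

  2∣n : 2 ∣ n
  2∣n = ∣-trans 2∣N N∣n

  1+[n∸1+t]≡n+t : ∀ t → 1 + ((n ∸ 1) + t) ≡ n + t
  1+[n∸1+t]≡n+t t = cong (_+ t) (m+[n∸m]≡n (>-nonZero⁻¹ n))

  isNG-g^[]-odd : ∀ s → ¬ 2 ∣ s → isNGᵇ p g^[ s ] ≡ sharesFactorᵇ s
  isNG-g^[]-odd s 2∤s = begin
    not (isQRᵇ p g^[ s ]) ∧ not (isGenᵇ p g^[ s ])
      ≡⟨ cong₂ (λ a b → not a ∧ not b) (trans (isQR-g^[] 2∣n s) (∤⇒∣ᵇ≡false 2∤s)) (isGen-g^[]-odd s 2∤s) ⟩
    not (not (sharesFactorᵇ s))
      ≡⟨ not-involutive (sharesFactorᵇ s) ⟩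
    sharesFactorᵇ s ∎
    where open ≡-Reasoning

  inRbar-g^[] : ∀ h t s → mulMod p h g^[ t ] ≡ g^[ s ] → (2 ∣ t → ¬ 2 ∣ s) →
    inRbarᵇ p h g^[ t ] ≡ 2 ∣ᵇ t ∧ sharesFactorᵇ s
  inRbar-g^[] h t s h*g^[t]≡g^[s] parity = begin
    isQRᵇ p g^[ t ] ∧ isNGᵇ p (mulMod p h g^[ t ]) ≡⟨ cong₂ (λ a b → a ∧ isNGᵇ p b) (isQR-g^[] 2∣n t) h*g^[t]≡g^[s] ⟩
    2 ∣ᵇ t ∧ isNGᵇ p g^[ s ]                      ≡⟨ ∧-congˡ-T (λ 2∣t → isNG-g^[]-odd s (parity (∣ᵇ⇒∣ 2∣t))) ⟩
    2 ∣ᵇ t ∧ sharesFactorᵇ s                      ∎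
    where open ≡-Reasoning

  neighboursShareᵇ : ℕ → Bool
  neighboursShareᵇ t = sharesFactorᵇ (1 + t) ∧ sharesFactorᵇ ((n ∸ 1) + t)

  NIᵇ : ℕ → Bool
  NIᵇ r = inRbarᵇ p g r ∧ inRbarᵇ p ginv r

  NI-g^[] : ∀ t → NIᵇ g^[ t ] ≡ 2 ∣ᵇ t ∧ neighboursShareᵇ t
  NI-g^[] t = trans (cong₂ _∧_ (inRbar-g^[] g t (1 + t) (g*g^[] t) 2∤1+t)
                               (inRbar-g^[] ginv t ((n ∸ 1) + t) (ginv*g^[] ginv g*ginv≡1 t) 2∤n∸1+t))
                    (∧-∧-same (2 ∣ᵇ t) _ _)
    where
    2≢1 : 2 ≢ 1
    2≢1 ()
    2∤1+t : 2 ∣ t → ¬ 2 ∣ 1 + t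
    2∤1+t 2∣t = 2≢1 ∘ ∣∧∣1+⇒≡1 2∣t
    2∤n∸1+t : 2 ∣ t → ¬ 2 ∣ (n ∸ 1) + t
    2∤n∸1+t 2∣t 2∣n∸1+t = 2≢1 (∣∧∣1+⇒≡1 2∣n∸1+t (subst (2 ∣_) (sym (1+[n∸1+t]≡n+t t)) (∣m∣n⇒∣m+n 2∣n 2∣t)))
    ∧-∧-same : ∀ a b c → (a ∧ b) ∧ (a ∧ c) ≡ a ∧ (b ∧ c)
    ∧-∧-same false b c = refl
    ∧-∧-same true b c = refl

  shares⇒⊎ : ∀ {s} → T (sharesFactorᵇ s) → q₁ ∣ s ⊎ q₂ ∣ s
  shares⇒⊎ = Sum.map ∣ᵇ⇒∣ ∣ᵇ⇒∣ ∘ Equivalence.to T-∨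

  neighbours⇒∤ : ∀ {qa qb} t → Prime qa → Prime qb → qb % 2 ≡ 1 → qa ∣ n → qb ∣ n →
    qa ∣ 1 + t ⊎ qb ∣ 1 + t → qa ∣ (n ∸ 1) + t ⊎ qb ∣ (n ∸ 1) + t → ¬ qa ∣ t
  neighbours⇒∤ {qa} {qb} t qa-prime qb-prime qb-odd qa∣n qb∣n left right qa∣t =
    prime≢1 qb-prime (odd⇒coprime-2 qb-odd (qb∣2 , ∣-refl))
    where
    prime≢1 : ∀ {q} → Prime q → q ≢ 1
    prime≢1 q-prime refl = ¬prime[1] q-prime
    qa∤1+t : ¬ qa ∣ 1 + t
    qa∤1+t = prime≢1 qa-prime ∘ ∣∧∣1+⇒≡1 qa∣t
    qa∤n∸1+t : ¬ qa ∣ (n ∸ 1) + t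
    qa∤n∸1+t qa∣n∸1+t = prime≢1 qa-prime
      (∣∧∣1+⇒≡1 qa∣n∸1+t (subst (qa ∣_) (sym (1+[n∸1+t]≡n+t t)) (∣m∣n⇒∣m+n qa∣n qa∣t)))
    qb∣1+t : qb ∣ 1 + t
    qb∣1+t = [ (λ qa∣1+t → contradiction qa∣1+t qa∤1+t) , id ]′ left
    qb∣n∸1+t : qb ∣ (n ∸ 1) + t
    qb∣n∸1+t = [ (λ x → contradiction x qa∤n∸1+t) , id ]′ right
    n+[1+t]≡[n∸1+t]+2 : n + (1 + t) ≡ ((n ∸ 1) + t) + 2
    n+[1+t]≡[n∸1+t]+2 = begin
      n + (1 + t)           ≡⟨ +-suc n t ⟩
      1 + (n + t)           ≡⟨ cong (1 +_) (1+[n∸1+t]≡n+t t) ⟨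
      2 + ((n ∸ 1) + t)     ≡⟨ +-comm 2 _ ⟩
      ((n ∸ 1) + t) + 2     ∎
      where open ≡-Reasoning
    qb∣2 : qb ∣ 2
    qb∣2 = ∣m+n∣m⇒∣n (subst (qb ∣_) n+[1+t]≡[n∸1+t]+2 (∣m∣n⇒∣m+n qb∣n qb∣1+t)) qb∣n∸1+t

  neighbours⇒coprime-m : ∀ t → T (neighboursShareᵇ t) → Coprime m t
  neighbours⇒coprime-m t share with Equivalence.to T-∧ share
  ... | left , right = coprime-m
    (neighbours⇒∤ t q₁-prime q₂-prime q₂-odd q₁∣n q₂∣n (shares⇒⊎ left) (shares⇒⊎ right))
    (neighbours⇒∤ t q₂-prime q₁-prime q₁-odd q₂∣n q₁∣n (Sum.swap (shares⇒⊎ left)) (Sum.swap (shares⇒⊎ right)))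
    where
    q₁∣n : q₁ ∣ n
    q₁∣n = ∣-trans q₁∣m m∣n
    q₂∣n : q₂ ∣ n
    q₂∣n = ∣-trans q₂∣m m∣n

  n≡2^k*[2^r*m] : ∀ k r → i ≡ k + r → n ≡ 2 ^ k * (2 ^ r * m)
  n≡2^k*[2^r*m] k r refl = begin
    n                     ≡⟨ n≡N*m ⟩
    2 ^ (k + r) * m       ≡⟨ cong (_* m) (^-distribˡ-+-* 2 k r) ⟩
    2 ^ k * 2 ^ r * m     ≡⟨ *-assoc (2 ^ k) (2 ^ r) m ⟩
    2 ^ k * (2 ^ r * m)   ∎
    where open ≡-Reasoning

  _/2^_ : ℕ → ℕ → ℕ
  x /2^ k = _/_ x (2 ^ k) {{m^n≢0 2 k}}

  n/2^k≡2^r*m : ∀ k r → i ≡ k + r → n /2^ k ≡ 2 ^ r * m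
  n/2^k≡2^r*m k r i≡k+r = begin
    n / 2 ^ k                   ≡⟨ cong (_/ 2 ^ k) (trans (n≡2^k*[2^r*m] k r i≡k+r) (*-comm (2 ^ k) _)) ⟩
    2 ^ r * m * 2 ^ k / 2 ^ k   ≡⟨ m*n/n≡m (2 ^ r * m) (2 ^ k) ⟩
    2 ^ r * m                   ∎
    where
    open ≡-Reasoning
    instance _ = m^n≢0 2 k

  module _ {t : ℕ} (m⊥t : Coprime m t) where

    order⇒2^k∣ : ∀ k r → i ≡ k + r → T (hasOrderᵇ p g^[ t ] (2 ^ r * m)) → 2 ^ k ∣ t
    order⇒2^k∣ k r i≡k+r order =
      additiveOrder⇒cofactor∣ (n≡2^k*[2^r*m] k r i≡k+r) (Equivalence.to (hasOrder-g^[]⇔ t _) order)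

    order⇒2^1+k∤ : ∀ k r → i ≡ k + suc r → T (hasOrderᵇ p g^[ t ] (2 ^ suc r * m)) → ¬ 2 ^ suc k ∣ t
    order⇒2^1+k∤ k r i≡k+1+r order 2^1+k∣t =
      additiveOrder⇒cofactor*∤ {c = 2 ^ k} {e = 2} {d = 2 ^ r * m}
        (trans (n≡2^k*[2^r*m] k (suc r) i≡k+1+r) (cong (2 ^ k *_) (*-assoc 2 (2 ^ r) m)))
        (s≤s (s≤s z≤n))
        (subst (IsAdditiveOrder n t) (*-assoc 2 (2 ^ r) m) (Equivalence.to (hasOrder-g^[]⇔ t _) order))
        (subst (_∣ t) (*-comm 2 (2 ^ k)) 2^1+k∣t)

    2-adic⇒order : ∀ k r u → i ≡ k + r → t ≡ u * 2 ^ k → Coprime (2 ^ r) u → T (hasOrderᵇ p g^[ t ] (2 ^ r * m))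
    2-adic⇒order k r u i≡k+r t≡u*2^k 2^r⊥u = Equivalence.from (hasOrder-g^[]⇔ t _)
      (isAdditiveOrder {{m^n≢0 2 k}} (n≡2^k*[2^r*m] k r i≡k+r) t≡u*2^k (>-nonZero⁻¹ _ {{m*n≢0 (2 ^ r) m {{m^n≢0 2 r}}}})
        (coprime-*ˡ 2^r⊥u (coprime-∣ʳ m⊥t (divides (2 ^ k) (trans t≡u*2^k (*-comm u (2 ^ k)))))))

    order-below-top : ∀ k j → i ≡ k + suc j → hasOrderᵇ p g^[ t ] (n /2^ k) ≡ 2^ k ∥ᵇ t
    order-below-top k j i≡k+1+j = trans (cong (hasOrderᵇ p g^[ t ]) (n/2^k≡2^r*m k (suc j) i≡k+1+j))
      (T-injective
        (λ order → Equivalence.from T-∧ (∣⇒∣ᵇ (order⇒2^k∣ k (suc j) i≡k+1+j order) ,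
                                        Equivalence.from T-not⇔¬T (order⇒2^1+k∤ k j i≡k+1+j order ∘ ∣ᵇ⇒∣)))
        (λ exact → let 2^k∣t , 2^1+k∤t = Equivalence.to T-∧ exact in exact⇒order (∣ᵇ⇒∣ 2^k∣t)
                     (Equivalence.to T-not⇔¬T 2^1+k∤t ∘ ∣⇒∣ᵇ)))
      where
      exact⇒order : 2 ^ k ∣ t → ¬ 2 ^ suc k ∣ t → T (hasOrderᵇ p g^[ t ] (2 ^ suc j * m))
      exact⇒order (divides u t≡u*2^k) 2^1+k∤t = 2-adic⇒order k (suc j) u i≡k+1+j t≡u*2^k
        (coprime-^ˡ (suc j) (prime∤⇒coprime prime[2] λ 2∣u →
          2^1+k∤t (subst (2 ^ suc k ∣_) (sym t≡u*2^k) (*-monoˡ-∣ (2 ^ k) 2∣u))))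

    order-top : hasOrderᵇ p g^[ t ] (n /2^ i) ≡ 2 ^ i ∣ᵇ t
    order-top = trans (cong (hasOrderᵇ p g^[ t ]) (n/2^k≡2^r*m i 0 i≡i+0))
      (T-injective (λ order → ∣⇒∣ᵇ (order⇒2^k∣ i 0 i≡i+0 order))
                   (λ 2^i∣t → top⇒order (∣ᵇ⇒∣ 2^i∣t)))
      where
      i≡i+0 : i ≡ i + 0
      i≡i+0 = sym (+-identityʳ i)
      top⇒order : 2 ^ i ∣ t → T (hasOrderᵇ p g^[ t ] (2 ^ 0 * m))
      top⇒order (divides u t≡u*2^i) = 2-adic⇒order i 0 u i≡i+0 t≡u*2^i (1-coprimeTo u)

  c₀ : ℕ
  c₀ = count neighboursShareᵇ m

  neighboursShare-periodic : ∀ t → neighboursShareᵇ t ≡ neighboursShareᵇ (t % m)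
  neighboursShare-periodic t = cong₂ _∧_ (sharesFactor-periodic 1) (sharesFactor-periodic (n ∸ 1))
    where
    [c+t]%m≡[c+t%m]%m : ∀ c → (c + t) % m ≡ (c + t % m) % m
    [c+t]%m≡[c+t%m]%m c = begin
      (c + t) % m               ≡⟨ %-distribˡ-+ c t m ⟩
      (c % m + t % m) % m       ≡⟨ cong (λ x → (c % m + x) % m) (m%n%n≡m%n t m) ⟨
      (c % m + t % m % m) % m   ≡⟨ %-distribˡ-+ c (t % m) m ⟨
      (c + t % m) % m           ∎
      where open ≡-Reasoning
    ∣ᵇ-periodic : ∀ {q} → q ∣ m → ∀ c → q ∣ᵇ (c + t) ≡ q ∣ᵇ (c + t % m)
    ∣ᵇ-periodic q∣m c = trans (∣ᵇ-cong-% q∣m (c + t))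
      (trans (cong (_ ∣ᵇ_) ([c+t]%m≡[c+t%m]%m c)) (sym (∣ᵇ-cong-% q∣m (c + t % m))))
    sharesFactor-periodic : ∀ c → sharesFactorᵇ (c + t) ≡ sharesFactorᵇ (c + t % m)
    sharesFactor-periodic c = cong₂ _∨_ (∣ᵇ-periodic q₁∣m c) (∣ᵇ-periodic q₂∣m c)

  count-crt-n : ∀ Q → (∀ t → Q t ≡ Q (t % N)) → count (λ t → Q t ∧ neighboursShareᵇ t) n ≡ c₀ * count Q N
  count-crt-n Q Q-periodic = trans (cong (count _) (trans n≡N*m (*-comm N m)))
    (count-crt N m Q neighboursShareᵇ Q-periodic neighboursShare-periodic N⊥m)

  length-NI≡ : ∀ i′ → i ≡ suc i′ → length (NI p g ginv) ≡ c₀ * 2 ^ i′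
  length-NI≡ i′ refl = begin
    length (NI p g ginv)                           ≡⟨ count-units NIᵇ ⟩
    count (NIᵇ ∘ g^[_]) n                          ≡⟨ count-cong n (λ t _ → NI-g^[] t) ⟩
    count (λ t → 2 ∣ᵇ t ∧ neighboursShareᵇ t) n    ≡⟨ count-crt-n (2 ∣ᵇ_) (∣ᵇ-cong-% 2∣N) ⟩
    c₀ * count (2 ∣ᵇ_) (2 * 2 ^ i′)                ≡⟨ cong (λ x → c₀ * count (2 ∣ᵇ_) x) (*-comm 2 (2 ^ i′)) ⟩
    c₀ * count (2 ∣ᵇ_) (2 ^ i′ * 2)                ≡⟨ cong (c₀ *_) (count-∣ᵇ 2 (2 ^ i′)) ⟩
    c₀ * 2 ^ i′                                    ∎
    where open ≡-Reasoning

  aₖ≡c₀*count : ∀ k (D : ℕ → Bool) → (∀ t → Coprime m t → hasOrderᵇ p g^[ t ] (n /2^ k) ≡ D t) →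
    (∀ t → D t ≡ D (t % N)) → aₖ p g ginv k ≡ c₀ * count (λ t → 2 ∣ᵇ t ∧ D t) N
  aₖ≡c₀*count k D order≡D D-periodic = begin
    aₖ p g ginv k
      ≡⟨ cong length (filter-∧ NIᵇ (λ r → hasOrderᵇ p r (n /2^ k)) (units p)) ⟩
    length (filter (λ r → T? (NIᵇ r ∧ hasOrderᵇ p r (n /2^ k))) (units p))
      ≡⟨ count-units (λ r → NIᵇ r ∧ hasOrderᵇ p r (n /2^ k)) ⟩
    count (λ t → NIᵇ g^[ t ] ∧ hasOrderᵇ p g^[ t ] (n /2^ k)) n
      ≡⟨ count-cong n (λ t _ → trans (cong (_∧ _) (NI-g^[] t))
           (∧-reorder (2 ∣ᵇ t) (order≡D t ∘ neighbours⇒coprime-m t))) ⟩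
    count (λ t → (2 ∣ᵇ t ∧ D t) ∧ neighboursShareᵇ t) n
      ≡⟨ count-crt-n (λ t → 2 ∣ᵇ t ∧ D t) (λ t → cong₂ _∧_ (∣ᵇ-cong-% 2∣N t) (D-periodic t)) ⟩
    c₀ * count (λ t → 2 ∣ᵇ t ∧ D t) N ∎
    where
    open ≡-Reasoning
    ∧-reorder : ∀ a {c o d} → (T c → o ≡ d) → (a ∧ c) ∧ o ≡ (a ∧ d) ∧ c
    ∧-reorder false _ = refl
    ∧-reorder true {false} _ = sym (∧-zeroʳ _)
    ∧-reorder true {true} o≡d = trans (o≡d _) (sym (∧-identityʳ _))

  aₖ-below-top : ∀ k j → 1 ≤ k → i ≡ k + suc j → aₖ p g ginv k ≡ c₀ * 2 ^ j
  aₖ-below-top k j 1≤k i≡k+1+j = trans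
    (aₖ≡c₀*count k (2^ k ∥ᵇ_) (λ t m⊥t → order-below-top m⊥t k j i≡k+1+j)
      (λ t → cong₂ (λ a b → a ∧ not b) (∣ᵇ-cong-% 2^k∣N t) (∣ᵇ-cong-% 2^1+k∣N t)))
    (cong (c₀ *_) (begin
      count (λ t → 2 ∣ᵇ t ∧ 2^ k ∥ᵇ t) N ≡⟨ count-cong N (λ t _ → ∧-absorbˡ (exact⇒even t)) ⟩
      count (2^ k ∥ᵇ_) N                  ≡⟨ cong (count (2^ k ∥ᵇ_)) N≡ ⟩
      count (2^ k ∥ᵇ_) (2 ^ j * 2 * 2 ^ k) ≡⟨ count-2^∥ᵇ k (2 ^ j) ⟩
      2 ^ j                               ∎))
    where
    open ≡-Reasoning
    exact⇒even : ∀ t → T (2^ k ∥ᵇ t) → T (2 ∣ᵇ t)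
    exact⇒even t exact = ∣⇒∣ᵇ (∣-trans (m∣m^n 2 1≤k) (∣ᵇ⇒∣ (proj₁ (Equivalence.to T-∧ exact))))
    2^k∣N : 2 ^ k ∣ N
    2^k∣N = subst (λ x → 2 ^ k ∣ 2 ^ x) (sym i≡k+1+j) (m^n∣m^[n+o] 2 k (suc j))
    2^1+k∣N : 2 ^ suc k ∣ N
    2^1+k∣N = subst (λ x → 2 ^ suc k ∣ 2 ^ x) (sym (trans i≡k+1+j (+-suc k j))) (m^n∣m^[n+o] 2 (suc k) j)
    N≡ : N ≡ 2 ^ j * 2 * 2 ^ k
    N≡ = begin
      2 ^ i                 ≡⟨ cong (2 ^_) (trans i≡k+1+j (+-comm k (suc j))) ⟩
      2 ^ (suc j + k)       ≡⟨ ^-distribˡ-+-* 2 (suc j) k ⟩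
      2 * 2 ^ j * 2 ^ k     ≡⟨ cong (_* 2 ^ k) (*-comm 2 (2 ^ j)) ⟩
      2 ^ j * 2 * 2 ^ k     ∎

  aᵢ≡c₀ : aₖ p g ginv i ≡ c₀
  aᵢ≡c₀ = begin
    aₖ p g ginv i                             ≡⟨ aₖ≡c₀*count i (2 ^ i ∣ᵇ_) (λ t m⊥t → order-top m⊥t) (∣ᵇ-cong-% ∣-refl) ⟩
    c₀ * count (λ t → 2 ∣ᵇ t ∧ 2 ^ i ∣ᵇ t) N  ≡⟨ cong (c₀ *_) (count-cong N (λ t _ → ∧-absorbˡ (∣⇒∣ᵇ ∘ ∣-trans 2∣N ∘ ∣ᵇ⇒∣))) ⟩
    c₀ * count (N ∣ᵇ_) N                      ≡⟨ cong (λ x → c₀ * count (N ∣ᵇ_) x) (*-identityˡ N) ⟨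
    c₀ * count (N ∣ᵇ_) (1 * N)                ≡⟨ cong (c₀ *_) (count-∣ᵇ N 1) ⟩
    c₀ * 1                                    ≡⟨ *-identityʳ c₀ ⟩
    c₀                                        ∎
    where open ≡-Reasoning

lemma10 : (p i j₁ j₂ q₁ q₂ : ℕ) → .{{_ : NonZero p}} →
    Prime p → Prime q₁ → Prime q₂ → q₁ ≢ q₂ →
    q₁ % 2 ≡ 1 → q₂ % 2 ≡ 1 →
    1 ≤ i → 1 ≤ j₁ → 1 ≤ j₂ →
    p ∸ 1 ≡ 2 ^ i * q₁ ^ j₁ * q₂ ^ j₂ →
    (g ginv : ℕ) → 1 ≤ g → g < p → T (isGenᵇ p g) →
    1 ≤ ginv → ginv < p → (g * ginv) % p ≡ 1 →
    (k : ℕ) → 1 ≤ k → k ≤ i →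
    (k < i → 2 ^ k * aₖ p g ginv k ≡ length (NI p g ginv))
    × (k ≡ i → 2 ^ (k ∸ 1) * aₖ p g ginv k ≡ length (NI p g ginv))
lemma10 p i j₁ j₂ q₁ q₂ p-prime q₁-prime q₂-prime _ q₁-odd q₂-odd 1≤i 1≤j₁ 1≤j₂ p∸1≡
        g ginv _ _ g-generator _ _ g*ginv≡1 k 1≤k _ = below-top , top
  where
  open TwoOddPrimes p i j₁ j₂ q₁ q₂ p-prime q₁-prime q₂-prime q₁-odd q₂-odd 1≤i 1≤j₁ 1≤j₂ p∸1≡
               g ginv g-generator g*ginv≡1
  open ≡-Reasoning
  i≡1+[i∸1] : i ≡ suc (i ∸ 1)
  i≡1+[i∸1] = sym (m+[n∸m]≡n 1≤i)
  below-top : k < i → 2 ^ k * aₖ p g ginv k ≡ length (NI p g ginv)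
  below-top k<i = begin
    2 ^ k * aₖ p g ginv k   ≡⟨ cong (2 ^ k *_) (aₖ-below-top k j 1≤k i≡k+1+j) ⟩
    2 ^ k * (c₀ * 2 ^ j)    ≡⟨ *-exchange (2 ^ k) c₀ (2 ^ j) ⟩
    c₀ * (2 ^ k * 2 ^ j)    ≡⟨ cong (c₀ *_) (^-distribˡ-+-* 2 k j) ⟨
    c₀ * 2 ^ (k + j)        ≡⟨ cong (λ x → c₀ * 2 ^ x) k+j≡i∸1 ⟩
    c₀ * 2 ^ (i ∸ 1)        ≡⟨ length-NI≡ (i ∸ 1) i≡1+[i∸1] ⟨
    length (NI p g ginv)    ∎
    where
    j : ℕ
    j = i ∸ suc k
    i≡k+1+j : i ≡ k + suc j
    i≡k+1+j = sym (trans (+-suc k j) (m+[n∸m]≡n k<i))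
    k+j≡i∸1 : k + j ≡ i ∸ 1
    k+j≡i∸1 = suc-injective (trans (sym (+-suc k j)) (trans (sym i≡k+1+j) i≡1+[i∸1]))
  top : k ≡ i → 2 ^ (k ∸ 1) * aₖ p g ginv k ≡ length (NI p g ginv)
  top refl = begin
    2 ^ (k ∸ 1) * aₖ p g ginv k ≡⟨ cong (2 ^ (k ∸ 1) *_) aᵢ≡c₀ ⟩
    2 ^ (k ∸ 1) * c₀            ≡⟨ *-comm (2 ^ (k ∸ 1)) c₀ ⟩
    c₀ * 2 ^ (k ∸ 1)            ≡⟨ length-NI≡ (k ∸ 1) i≡1+[i∸1] ⟨
    length (NI p g ginv)        ∎
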